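{- Every finitely generated group is weakly amenable.
   Context: A countable group $G$ is weakly amenable if either $G$ is finite, or there is an equivalence relation $\sim$ on $G$ such that (1) $G/\!\sim$ is infinite, (2) for every $g\in G$ there is $b(g)\in\mathbb{N}$ such that for every class $C\in G/\!\sim$, $|\{C'\in G/\!\sim: gC\cap C'\neq\emptyset\}|\le b(g)$; and there is an increasing sequence of finite sets $A_n\subseteq G/\!\sim$ with $\bigcup_n A_n=G/\!\sim$ such that for every $g\in G$, $\lim_{n\to\infty}|\{C\in A_n: gC\subseteq \bigcup A_n\}|/|A_n|=1$, where $\bigcup A_n$ is the union of the classes in $A_n$. -}

module Defs where

open import Level using (0ℓ)
open import Algebra.Bundles using (Group)
open import Data.Nat using (ℕ; zero; suc; _+_; _*_; _∸_; _≤_)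
open import Data.List using (List; []; _∷_; length; foldr)
open import Data.List.Relation.Unary.All using (All)
open import Data.List.Relation.Unary.Any using (Any)
open import Data.List.Relation.Unary.AllPairs using (AllPairs)
open import Data.List.Membership.Propositional using (_∈_)
open import Data.Product using (Σ; ∃; _×_; _,_)
open import Data.Sum using (_⊎_)
open import Relation.Nullary using (¬_)
open import Relation.Binary using (Rel; IsEquivalence)

FiniteMod : {A : Set} → Rel A 0ℓ → Set
FiniteMod {A} R = Σ (List A) λ xs → (x : A) → Any (R x) xs

InfiniteMod : {A : Set} → Rel A 0ℓ → Set
InfiniteMod R = ¬ FiniteMod R

data Count {A : Set} (P : A → Set) : List A → ℕ → Set where
  c-nil : Count P [] 0
  c-yes : ∀ {x xs k} → P x → Count P xs k → Count P (x ∷ xs) (suc k)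
  c-no  : ∀ {x xs k} → ¬ P x → Count P xs k → Count P (x ∷ xs) k

module _ (G : Group 0ℓ 0ℓ) where
  open Group G

  GeneratedBy : List Carrier → Set
  GeneratedBy gens = (g : Carrier) →
    Σ (List Carrier) λ ws →
      All (λ w → w ∈ gens ⊎ (w ⁻¹) ∈ gens) ws × (g ≈ foldr _∙_ ε ws)

  FinitelyGenerated : Set
  FinitelyGenerated = Σ (List Carrier) GeneratedBy

  -- Weak amenability data for an equivalence relation ~ on G
  -- (classes of ~ are represented by representatives; ~ must contain ≈,
  --  so that it is a relation on the group elements).
  -- A : ℕ → List Carrier lists representatives of the classes in A_n,
  -- pairwise non-equivalent, so |A_n| = length (A n).
  module _ (_~_ : Rel Carrier 0ℓ) where

    -- "gC meets at most b classes", C = class of x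
    BoundedSpread : Carrier → ℕ → Set
    BoundedSpread g b = (x : Carrier) (ys : List Carrier) →
      All (λ y → Σ Carrier λ z → (z ~ x) × ((g ∙ z) ~ y)) ys →
      AllPairs (λ a c → ¬ (a ~ c)) ys →
      length ys ≤ b

    -- gC ⊆ ⋃ A_n, C = class of x
    TranslateInside : List Carrier → Carrier → Carrier → Set
    TranslateInside An g x = (z : Carrier) → z ~ x → Any (λ a → (g ∙ z) ~ a) An

    -- |{C ∈ A_n : gC ⊆ ⋃A_n}| / |A_n| → 1, written without division:
    -- for every k, eventually the ratio is ≥ 1 - 1/(k+1).
    RatioTendsToOne : (ℕ → List Carrier) → Carrier → Set
    RatioTendsToOne A g = (k : ℕ) → Σ ℕ λ N → (n : ℕ) → N ≤ n →
      Σ ℕ λ c → Count (TranslateInside (A n) g) (A n) c ×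
        (suc k * (length (A n) ∸ c) ≤ length (A n))

    IsWeakAmenabilityWitness : Set
    IsWeakAmenabilityWitness =
      IsEquivalence _~_ ×
      (∀ {x y} → x ≈ y → x ~ y) ×
      InfiniteMod _~_ ×
      ((g : Carrier) → Σ ℕ λ b → BoundedSpread g b) ×
      Σ (ℕ → List Carrier) λ A →
        ((n : ℕ) → AllPairs (λ a c → ¬ (a ~ c)) (A n)) ×
        ((n : ℕ) → All (λ a → Any (a ~_) (A (suc n))) (A n)) ×
        ((x : Carrier) → Σ ℕ λ n → Any (x ~_) (A n)) ×
        ((g : Carrier) → RatioTendsToOne A g)

  WeaklyAmenable : Set₁
  WeaklyAmenable = FiniteMod _≈_ ⊎ Σ (Rel Carrier 0ℓ) IsWeakAmenabilityWitness

module Submission where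

-- Let |_| be the word length with respect to a finite generating set.
-- If G is infinite, every sphere S_m = {x : |x| = m} is nonempty (otherwise
-- G would lie in a ball, which is finite).  Take x ~ y iff |x| = |y|, so the
-- classes are the spheres, and let A_n = {S_0, …, S_n}.
--   * Translation by g changes lengths by at most |g| upwards and |g⁻¹|
--     downwards, so gS_m meets at most |g| + |g⁻¹| + 1 spheres.
--   * If m + |g| ≤ n then gS_m ⊆ S_0 ∪ … ∪ S_n, so at most |g| of the n + 1
--     classes in A_n are bad, and the proportion of good ones tends to 1.

open import Defs
open import Level using (0ℓ)
open import Algebra.Bundles using (Group)
import Algebra.Properties.Group as GroupProperties
open import Axiom.ExcludedMiddle using (ExcludedMiddle)
open import Data.Nat using (ℕ; zero; suc; _+_; _*_; _∸_; _≤_; _<_; _⊔_; z≤n; s≤s)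
open import Data.Nat.Properties
open import Data.Nat.Induction using (<-rec)
open import Data.Fin using (Fin; toℕ; fromℕ<)
open import Data.Fin.Properties using (injective⇒≤; toℕ-fromℕ<)
open import Data.List using (List; []; _∷_; length; foldr; map; drop; lookup; _++_; cartesianProductWith)
open import Data.List.Properties using (length-++)
open import Data.List.Relation.Unary.All using (All; []; _∷_)
import Data.List.Relation.Unary.All as All
import Data.List.Relation.Unary.All.Properties as AllProperties
open import Data.List.Relation.Unary.Any using (Any; here; there)
import Data.List.Relation.Unary.Any as Any
open import Data.List.Relation.Unary.Any.Properties using (++⁺ˡ; ++⁺ʳ; map⁺; cartesianProductWith⁺)
open import Data.List.Relation.Unary.AllPairs using (AllPairs; []; _∷_)
open import Data.List.Membership.Propositional using (_∈_)
open import Data.List.Membership.Propositional.Properties using (∈-lookup)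
open import Data.Product using (Σ; _×_; _,_; proj₁; proj₂)
open import Data.Sum using (_⊎_; inj₁; inj₂)
open import Data.Empty using (⊥-elim)
open import Function.Definitions using (Injective)
open import Relation.Nullary using (¬_; yes; no; contradiction)
open import Relation.Binary using (Rel)
import Relation.Binary.Construct.On as On
open import Relation.Binary.PropositionalEquality
  using (_≡_; _≢_; refl; sym; trans; cong; subst; isEquivalence)

lookup-injective : ∀ {A : Set} (f : A → ℕ) {xs : List A} →
  AllPairs (λ a c → f a ≢ f c) xs →
  ∀ i j → f (lookup xs i) ≡ f (lookup xs j) → i ≡ j
lookup-injective f (_  ∷ _)  Fin.zero    Fin.zero    _ = refl
lookup-injective f (hd ∷ _)  Fin.zero    (Fin.suc j) e = ⊥-elim (All.lookup hd (∈-lookup j) e)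
lookup-injective f (hd ∷ _)  (Fin.suc i) Fin.zero    e = ⊥-elim (All.lookup hd (∈-lookup i) (sym e))
lookup-injective f (_  ∷ tl) (Fin.suc i) (Fin.suc j) e = cong Fin.suc (lookup-injective f tl i j e)

distinct-values-≤ : ∀ {A : Set} (f : A → ℕ) (lo B : ℕ) (xs : List A) →
  AllPairs (λ a c → f a ≢ f c) xs →
  All (λ a → lo ≤ f a × f a < lo + B) xs →
  length xs ≤ B
distinct-values-≤ f lo B xs distinct inRange = injective⇒≤ slot-injective
  where
    value : Fin (length xs) → ℕ
    value i = f (lookup xs i)

    lo≤value : ∀ i → lo ≤ value i
    lo≤value i = proj₁ (All.lookup inRange (∈-lookup i))

    offset<B : ∀ i → value i ∸ lo < B
    offset<B i = subst (value i ∸ lo <_) (m+n∸m≡n lo B)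
      (∸-monoˡ-< (proj₂ (All.lookup inRange (∈-lookup i))) (lo≤value i))

    slot : Fin (length xs) → Fin B
    slot i = fromℕ< (offset<B i)

    slot-injective : Injective _≡_ _≡_ slot
    slot-injective {i} {j} e = lookup-injective f distinct i j
      (∸-cancelʳ-≡ (lo≤value i) (lo≤value j)
        (trans (sym (toℕ-fromℕ< (offset<B i)))
          (trans (cong toℕ e) (toℕ-fromℕ< (offset<B j)))))

count-after-drop : ∀ {A : Set} {P : A → Set} K (xs : List A) {c} →
  All P (drop K xs) → Count P xs c → length xs ≤ K + c
count-after-drop _       []       _          c-nil           = z≤n
count-after-drop zero    (_ ∷ xs) (_ ∷ ps)   (c-yes _ cnt)   = s≤s (count-after-drop zero xs ps cnt)
count-after-drop zero    (_ ∷ _)  (p ∷ _)    (c-no ¬p _)     = ⊥-elim (¬p p)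
count-after-drop (suc K) (_ ∷ xs) ps         (c-yes {k = c} _ cnt) =
  s≤s (≤-trans (count-after-drop K xs ps cnt) (+-monoʳ-≤ K (n≤1+n c)))
count-after-drop (suc K) (_ ∷ xs) ps         (c-no _ cnt)    = s≤s (count-after-drop K xs ps cnt)

bounded-on-list : ∀ {A : Set} (f : A → ℕ) (xs : List A) →
  Σ ℕ λ b → ∀ {x} → Any (λ y → f x ≡ f y) xs → f x ≤ b
bounded-on-list f []       = 0 , λ ()
bounded-on-list f (y ∷ ys) with bounded-on-list f ys
... | b , bounded = f y ⊔ b , λ
  { (here e)  → ≤-trans (≤-reflexive e) (m≤m⊔n (f y) b)
  ; (there a) → ≤-trans (bounded a) (m≤n⊔m (f y) b) }


Least : (ℕ → Set) → Set
Least P = Σ ℕ λ m → P m × (∀ k → P k → m ≤ k)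

module Classical (lem : ExcludedMiddle 0ℓ) where

  least : (P : ℕ → Set) → ∀ n → P n → Least P
  least P = <-rec (λ n → P n → Least P) step
    where
      step : ∀ n → (∀ {k} → k < n → P k → Least P) → P n → Least P
      step n smaller pn with lem {Σ ℕ λ k → k < n × P k}
      ... | yes (k , k<n , pk) = smaller k<n pk
      ... | no none = n , pn , λ k pk → ≮⇒≥ (λ k<n → none (k , k<n , pk))

  count : ∀ {A : Set} (P : A → Set) (xs : List A) → Σ ℕ (Count P xs)
  count P [] = 0 , c-nil
  count P (x ∷ xs) with count P xs | lem {P x}
  ... | c , cnt | yes p  = suc c , c-yes p cnt
  ... | c , cnt | no ¬p  = c , c-no ¬p cnt


module _ (G : Group 0ℓ 0ℓ) where
  open Group G using (Carrier; _≈_; _∙_; ε; _⁻¹; ∙-cong; assoc; identityˡ; identityʳ)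
    renaming (refl to ≈-refl; sym to ≈-sym; trans to ≈-trans)
  open GroupProperties G using (\\-leftDividesʳ; ⁻¹-involutive)

  record ProperLength : Set where
    field
      len         : Carrier → ℕ
      len-cong    : ∀ {x y} → x ≈ y → len x ≡ len y
      len-sub     : ∀ g x → len (g ∙ x) ≤ len g + len x
      shorten     : ∀ x m → len x ≡ suc m → Σ Carrier λ y → len y ≡ m
      finite-ball : ∀ m → Σ (List Carrier) λ xs → ∀ x → len x ≤ m → Any (x ≈_) xs

  module Spheres (lem : ExcludedMiddle 0ℓ) (L : ProperLength) where
    open ProperLength L
    open Classical lem using (count)

    len-sub-inverse : ∀ g x → len x ≤ len (g ⁻¹) + len (g ∙ x)
    len-sub-inverse g x =
      subst (_≤ len (g ⁻¹) + len (g ∙ x)) (len-cong (\\-leftDividesʳ g x)) (len-sub (g ⁻¹) (g ∙ x))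

    Sphere : ℕ → Set
    Sphere m = Σ Carrier λ x → len x ≡ m

    sphere-down : ∀ d {m} → Sphere (d + m) → Sphere m
    sphere-down zero    s           = s
    sphere-down (suc d) {m} (x , e) = sphere-down d (shorten x (d + m) e)

    empty-sphere⇒finite : ∀ m → ¬ Sphere m → FiniteMod _≈_
    empty-sphere⇒finite m empty with finite-ball m
    ... | ball , covers = ball , λ x → covers x (within x)
      where
        within : ∀ x → len x ≤ m
        within x with ≤-total (len x) m
        ... | inj₁ x≤m = x≤m
        ... | inj₂ m≤x = ⊥-elim (empty (sphere-down (len x ∸ m) (x , sym (m∸n+n≡m m≤x))))

    _~_ : Rel Carrier 0ℓ
    x ~ y = len x ≡ len y

    module Infinite (infinite : ¬ FiniteMod _≈_) where

      sphere : ∀ m → Sphere m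
      sphere m with lem {Sphere m}
      ... | yes s     = s
      ... | no  empty = ⊥-elim (infinite (empty-sphere⇒finite m empty))

      rep : ℕ → Carrier
      rep m = proj₁ (sphere m)

      len-rep : ∀ m → len (rep m) ≡ m
      len-rep m = proj₂ (sphere m)

      infinitely-many : InfiniteMod _~_
      infinitely-many (xs , covers) with bounded-on-list len xs
      ... | b , bounded =
        1+n≰n (subst (_≤ b) (len-rep (suc b)) (bounded (covers (rep (suc b)))))

      A : ℕ → List Carrier
      A zero    = rep 0 ∷ []
      A (suc n) = rep (suc n) ∷ A n

      length-A : ∀ n → length (A n) ≡ suc n
      length-A zero    = refl
      length-A (suc n) = cong suc (length-A n)

      A-tail : ∀ K n → All (λ a → K + len a ≤ n) (drop K (A n))
      A-tail zero          zero    = ≤-reflexive (len-rep 0) ∷ []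
      A-tail zero          (suc n) = ≤-reflexive (len-rep (suc n)) ∷ All.map m≤n⇒m≤1+n (A-tail zero n)
      A-tail (suc zero)    zero    = []
      A-tail (suc (suc K)) zero    = []
      A-tail (suc K)       (suc n) = All.map s≤s (A-tail K n)

      A-bounded : ∀ n → All (λ a → len a ≤ n) (A n)
      A-bounded = A-tail zero

      A-hits : ∀ n i → i ≤ n → Any (λ a → i ≡ len a) (A n)
      A-hits zero    i i≤0 = here (trans (n≤0⇒n≡0 i≤0) (sym (len-rep 0)))
      A-hits (suc n) i i≤n with i ≟ suc n
      ... | yes refl = here (sym (len-rep (suc n)))
      ... | no  i≢n  = there (A-hits n i (≤-pred (≤∧≢⇒< i≤n i≢n)))

      A-distinct : ∀ n → AllPairs (λ a c → ¬ (a ~ c)) (A n)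
      A-distinct zero    = [] ∷ []
      A-distinct (suc n) =
        All.map (λ a≤n e → 1+n≰n (subst (_≤ n) (trans (sym e) (len-rep (suc n))) a≤n)) (A-bounded n)
        ∷ A-distinct n

      -- gS_m meets only spheres of radius in [m - |g⁻¹|, m + |g|].
      bounded-spread : ∀ g → Σ ℕ (BoundedSpread G _~_ g)
      bounded-spread g = suc (len g + len (g ⁻¹)) , λ x ys reached distinct →
        distinct-values-≤ len (len x ∸ len (g ⁻¹)) _ ys distinct (All.map (window x) reached)
        where
          window : ∀ x {y} → Σ Carrier (λ z → (z ~ x) × ((g ∙ z) ~ y)) →
                   (len x ∸ len (g ⁻¹) ≤ len y) × (len y < len x ∸ len (g ⁻¹) + suc (len g + len (g ⁻¹)))
          window x {y} (z , z~x , gz~y) = lower , upper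
            where
              open ≤-Reasoning
              lower : len x ∸ len (g ⁻¹) ≤ len y
              lower = m≤n+o⇒m∸n≤o (len x) (len (g ⁻¹)) (begin
                len x                        ≡⟨ sym z~x ⟩
                len z                        ≤⟨ len-sub-inverse g z ⟩
                len (g ⁻¹) + len (g ∙ z)     ≡⟨ cong (len (g ⁻¹) +_) gz~y ⟩
                len (g ⁻¹) + len y           ∎)
              upper : len y < len x ∸ len (g ⁻¹) + suc (len g + len (g ⁻¹))
              upper = begin-strict
                len y                                      ≡⟨ sym gz~y ⟩
                len (g ∙ z)                                ≤⟨ len-sub g z ⟩
                len g + len z                              ≡⟨ cong (len g +_) z~x ⟩
                len g + len x                              ≤⟨ +-monoʳ-≤ (len g) (m≤n+m∸n (len x) (len (g ⁻¹))) ⟩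
                len g + (len (g ⁻¹) + (len x ∸ len (g ⁻¹))) ≡⟨ sym (+-assoc (len g) _ _) ⟩
                len g + len (g ⁻¹) + (len x ∸ len (g ⁻¹))  ≡⟨ +-comm (len g + len (g ⁻¹)) _ ⟩
                len x ∸ len (g ⁻¹) + (len g + len (g ⁻¹))  <⟨ +-monoʳ-< (len x ∸ len (g ⁻¹)) ≤-refl ⟩
                len x ∸ len (g ⁻¹) + suc (len g + len (g ⁻¹)) ∎

      translate-inside : ∀ g n {a} → len g + len a ≤ n → TranslateInside G _~_ (A n) g a
      translate-inside g n {a} le z z~a = A-hits n (len (g ∙ z)) (begin
        len (g ∙ z)   ≤⟨ len-sub g z ⟩
        len g + len z ≡⟨ cong (len g +_) z~a ⟩
        len g + len a ≤⟨ le ⟩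
        n             ∎)
        where open ≤-Reasoning

      -- At most |g| of the n + 1 classes of A n are bad, so beyond
      -- n = (k + 1)|g| the bad proportion is at most 1/(k + 1).
      ratio-tends-to-one : ∀ g → RatioTendsToOne G _~_ A g
      ratio-tends-to-one g k = suc k * len g , λ n N≤n →
        let c , cnt = count (TranslateInside G _~_ (A n) g) (A n)
            good : All (TranslateInside G _~_ (A n) g) (drop (len g) (A n))
            good = All.map (translate-inside g n) (A-tail (len g) n)
            few-bad : length (A n) ∸ c ≤ len g
            few-bad = m≤n+o⇒m∸n≤o (length (A n)) c
                        (subst (length (A n) ≤_) (+-comm (len g) c) (count-after-drop (len g) (A n) good cnt))
        in c , cnt , (begin
          suc k * (length (A n) ∸ c) ≤⟨ *-monoʳ-≤ (suc k) few-bad ⟩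
          suc k * len g              ≤⟨ N≤n ⟩
          n                          ≤⟨ n≤1+n n ⟩
          suc n                      ≡⟨ sym (length-A n) ⟩
          length (A n)               ∎)
        where open ≤-Reasoning

      witness : IsWeakAmenabilityWitness G _~_
      witness =
        On.isEquivalence len isEquivalence ,
        len-cong ,
        infinitely-many ,
        bounded-spread ,
        A ,
        A-distinct ,
        (λ n → All.map (λ a≤n → A-hits (suc n) _ (m≤n⇒m≤1+n a≤n)) (A-bounded n)) ,
        (λ x → len x , A-hits (len x) (len x) ≤-refl) ,
        ratio-tends-to-one


  module WordLength (lem : ExcludedMiddle 0ℓ) (gens : List Carrier) (generated : GeneratedBy G gens) where
    open Classical lem using (least)

    Letter : Carrier → Set
    Letter w = w ∈ gens ⊎ (w ⁻¹) ∈ gens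

    eval : List Carrier → Carrier
    eval = foldr _∙_ ε

    ShortWord : Carrier → ℕ → Set
    ShortWord g n = Σ (List Carrier) λ ws → All Letter ws × length ws ≤ n × g ≈ eval ws

    shortest : ∀ g → Least (ShortWord g)
    shortest g with generated g
    ... | ws , ls , g≈ws = least (ShortWord g) (length ws) (ws , ls , ≤-refl , g≈ws)

    len : Carrier → ℕ
    len g = proj₁ (shortest g)

    len-spelled : ∀ g → ShortWord g (len g)
    len-spelled g = proj₁ (proj₂ (shortest g))

    len-minimal : ∀ g n → ShortWord g n → len g ≤ n
    len-minimal g = proj₂ (proj₂ (shortest g))

    len-cong : ∀ {g h} → g ≈ h → len g ≡ len h
    len-cong {g} {h} g≈h = ≤-antisym
      (len-minimal g (len h) (respell g≈h (len-spelled h)))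
      (len-minimal h (len g) (respell (≈-sym g≈h) (len-spelled g)))
      where
        respell : ∀ {g h n} → g ≈ h → ShortWord h n → ShortWord g n
        respell g≈h (ws , ls , short , h≈ws) = ws , ls , short , ≈-trans g≈h h≈ws

    eval-++ : ∀ ws vs → eval (ws ++ vs) ≈ eval ws ∙ eval vs
    eval-++ []       vs = ≈-sym (identityˡ _)
    eval-++ (w ∷ ws) vs = ≈-trans (∙-cong ≈-refl (eval-++ ws vs)) (≈-sym (assoc _ _ _))

    -- Concatenating spellings spells the product.
    len-sub : ∀ g x → len (g ∙ x) ≤ len g + len x
    len-sub g x with len-spelled g | len-spelled x
    ... | ws , ls , short , g≈ws | vs , ls′ , short′ , x≈vs =
      len-minimal (g ∙ x) (len g + len x)
        ( ws ++ vs
        , AllProperties.++⁺ ls ls′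
        , subst (_≤ len g + len x) (sym (length-++ ws)) (+-mono-≤ short short′)
        , ≈-trans (∙-cong g≈ws x≈vs) (≈-sym (eval-++ ws vs)) )

    len-letter : ∀ {w} → Letter w → len w ≤ 1
    len-letter {w} letter = len-minimal w 1 (w ∷ [] , letter ∷ [] , ≤-refl , ≈-sym (identityʳ w))

    -- Dropping the first letter of a shortest spelling shortens by exactly one.
    shorten : ∀ x m → len x ≡ suc m → Σ Carrier λ y → len y ≡ m
    shorten x m len-x with len-spelled x
    ... | [] , _ , _ , x≈ε =
      contradiction (subst (_≤ 0) len-x (len-minimal x 0 ([] , [] , z≤n , x≈ε))) λ ()
    ... | w ∷ vs , letter ∷ ls , short , x≈wvs = eval vs , ≤-antisym at-most at-least
      where
        open ≤-Reasoning
        at-most : len (eval vs) ≤ m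
        at-most = len-minimal (eval vs) m (vs , ls , ≤-pred (subst (_ ≤_) len-x short) , ≈-refl)
        at-least : m ≤ len (eval vs)
        at-least = ≤-pred (begin
          suc m                 ≡⟨ sym len-x ⟩
          len x                 ≡⟨ len-cong x≈wvs ⟩
          len (w ∙ eval vs)     ≤⟨ len-sub w (eval vs) ⟩
          len w + len (eval vs) ≤⟨ +-monoˡ-≤ (len (eval vs)) (len-letter letter) ⟩
          suc (len (eval vs))   ∎)

    letters : List Carrier
    letters = gens ++ map _⁻¹ gens

    letter-listed : ∀ {w} → Letter w → Any (w ≈_) letters
    letter-listed (inj₁ w∈gens)   = ++⁺ˡ (Any.map (λ { refl → ≈-refl }) w∈gens)
    letter-listed (inj₂ w⁻¹∈gens) = ++⁺ʳ gens (map⁺ (Any.map (λ { refl → ≈-sym (⁻¹-involutive _) }) w⁻¹∈gens))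

    word-ball : ∀ n → Σ (List Carrier) λ xs →
      ∀ ws → All Letter ws → length ws ≤ n → Any (eval ws ≈_) xs
    word-ball zero = ε ∷ [] , λ { [] _ _ → here ≈-refl ; (_ ∷ _) _ () }
    word-ball (suc n) with word-ball n
    ... | xs , covers = xs ++ cartesianProductWith _∙_ letters xs , extend
      where
        extend : ∀ ws → All Letter ws → length ws ≤ suc n → Any (eval ws ≈_) _
        extend []       _             _           = ++⁺ˡ (covers [] [] z≤n)
        extend (w ∷ vs) (letter ∷ ls) (s≤s short) =
          ++⁺ʳ xs (cartesianProductWith⁺ _∙_ ∙-cong (letter-listed letter) (covers vs ls short))

    -- Balls are finite: everything of length ≤ m is the value of a short word.
    finite-ball : ∀ m → Σ (List Carrier) λ xs → ∀ x → len x ≤ m → Any (x ≈_) xs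
    finite-ball m with word-ball m
    ... | xs , covers = xs , λ x len-x≤m → spelled-in x len-x≤m (len-spelled x)
      where
        spelled-in : ∀ x → len x ≤ m → ShortWord x (len x) → Any (x ≈_) xs
        spelled-in x le (ws , ls , short , x≈ws) = Any.map (≈-trans x≈ws) (covers ws ls (≤-trans short le))

    wordLength : ProperLength
    wordLength = record
      { len = len ; len-cong = len-cong ; len-sub = len-sub
      ; shorten = shorten ; finite-ball = finite-ball }


theorem3p3 : ExcludedMiddle 0ℓ → (G : Group 0ℓ 0ℓ) → FinitelyGenerated G → WeaklyAmenable G
theorem3p3 lem G (gens , generated) with lem {FiniteMod (Group._≈_ G)}
... | yes finite  = inj₁ finite
... | no infinite = inj₂ (_ , Infinite.witness infinite)
  where open Spheres G lem (WordLength.wordLength G lem gens generated)
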